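{- At any decision time step, a maximal increasing (respectively decreasing) run $r$ that can be written starting at that step covers every other (non-maximal) increasing (respectively decreasing) run $r'$ that can be written starting at that step.
   Context: Up-down run generation problem: an input stream of elements from a totally ordered set is presented in order to an algorithm with a buffer of $M$ slots; the algorithm reads elements in order into the buffer and writes elements from the buffer to an output sequence, each write freeing a slot that is filled by the next input element. A run is a sorted (increasing) or reverse-sorted (decreasing) sequence. Time step $t$ means exactly $t$ elements have been written; $t$ is a decision point if $t=0$ or a run has just been finished at $t$. A maximal increasing run is written by starting with the smallest buffered element, always writing the smallest buffered element larger than the last element written, and ending only when every buffered element is smaller than the last written; maximal decreasing runs are symmetric. A sequence $A$ covers a sequence $B$ if every element of $B$ occurs in $A$. -}

module Defs where

open import Data.Nat using (ℕ)
open import Data.List using (List; []; _∷_; _++_; take; drop; concat; map)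
open import Data.List.Relation.Unary.Any using (_─_)
open import Data.List.Relation.Unary.Linked using (Linked)
open import Data.List.Membership.Propositional using (_∈_)
open import Data.Maybe using (Maybe; nothing; just)
open import Data.Product using (_×_; _,_; proj₁; proj₂; Σ)
open import Data.Unit using (⊤)
open import Data.Empty using (⊥)
open import Relation.Binary.PropositionalEquality using (_≡_)
open import Relation.Nullary using (¬_)

record Config (A : Set) : Set where
  constructor ⟨_,_⟩
  field
    buffer : List A
    input  : List A
open Config public

initial : {A : Set} → ℕ → List A → Config A
initial M I = ⟨ take M I , drop M I ⟩

next : {A : Set} (c : Config A) {x : A} → x ∈ buffer c → Config A
next c p = ⟨ (buffer c ─ p) ++ take 1 (input c) , drop 1 (input c) ⟩

data Writes {A : Set} : Config A → List A → Config A → Set where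
  done  : ∀ {c} → Writes c [] c
  write : ∀ {c x xs c'} (p : x ∈ buffer c) →
          Writes (next c p) xs c' → Writes c (x ∷ xs) c'

data Dir : Set where
  up down : Dir

Ord : {A : Set} → (A → A → Set) → Dir → A → A → Set
Ord _<_ up   x y = x < y
Ord _<_ down x y = y < x

IsRun : {A : Set} → (A → A → Set) → Dir → List A → Set
IsRun _<_ d xs = Linked (Ord _<_ d) xs

-- Time step reached after writing a sequence of completed runs from the
-- initial configuration: a decision point (t = 0 is the empty list of runs).
DecisionPoint : {A : Set} → (A → A → Set) → ℕ → List A → Config A → Set
DecisionPoint {A} _<_ M I c =
  Σ (List (Dir × List A)) λ rs →
    (∀ {r} → r ∈ rs → IsRun _<_ (proj₁ r) (proj₂ r)) ×
    Writes (initial M I) (concat (map proj₂ rs)) c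

Eligible : {A : Set} → (A → A → Set) → Dir → Maybe A → A → Set
Eligible _<_ d nothing  y = ⊤
Eligible _<_ d (just l) y = Ord _<_ d l y

CanEnd : {A : Set} → (A → A → Set) → Dir → Maybe A → Config A → Set
CanEnd _<_ d nothing  c = buffer c ≡ []
CanEnd _<_ d (just l) c = ∀ {y} → y ∈ buffer c → Ord _<_ d y l

-- Each step writes the smallest (d = up) / largest (d = down)
-- buffered element that is eligible; the run ends only when CanEnd holds.
data MaxRunFrom {A : Set} (_<_ : A → A → Set) (d : Dir) :
       Maybe A → Config A → List A → Set where
  stop : ∀ {last c} → CanEnd _<_ d last c → MaxRunFrom _<_ d last c []
  step : ∀ {last c x xs} (p : x ∈ buffer c) →
         Eligible _<_ d last x →
         (∀ {y} → y ∈ buffer c → Eligible _<_ d last y → ¬ Ord _<_ d y x) →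
         MaxRunFrom _<_ d (just x) (next c p) xs →
         MaxRunFrom _<_ d last c (x ∷ xs)

MaxRun : {A : Set} → (A → A → Set) → Dir → Config A → List A → Set
MaxRun _<_ d c r = MaxRunFrom _<_ d nothing c r

Covers : {A : Set} → List A → List A → Set
Covers a b = ∀ {x} → x ∈ b → x ∈ a

-- Run the maximal run and an arbitrary run r' of the same direction side by
-- side.  Both read the same input, and as long as the last element written by
-- the maximal run is not beyond the last element of r', every buffered element
-- that r' could still write is also in the maximal run's buffer (new input
-- reaches both buffers alike).  Since the maximal run writes the least eligible
-- element, this invariant survives each step; and an element that is eligible
-- and buffered is eventually written by the maximal run, as it cannot stop
-- while such an element remains.
module Submission where

open import Defs
open import Data.Nat using (ℕ)
open import Data.List using (List; []; _∷_; _++_; take; drop)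
open import Data.List.Relation.Unary.Any using (here; there; _─_)
open import Data.List.Relation.Unary.Linked using (_∷_)
open import Data.List.Membership.Propositional using (_∈_)
open import Data.List.Relation.Unary.Any.Properties using (¬Any[])
open import Data.List.Membership.Propositional.Properties using (∈-++⁺ˡ; ∈-++⁺ʳ; ∈-++⁻)
open import Data.Maybe using (Maybe; nothing; just)
open import Data.Product using (_×_; _,_)
open import Data.Sum using (inj₁; inj₂)
open import Data.Unit using (tt)
open import Data.Empty using (⊥-elim)
open import Relation.Nullary using (¬_)
open import Relation.Binary.PropositionalEquality using (_≡_; _≢_; refl; sym; cong; subst)
open import Relation.Binary.Structures using (IsStrictTotalOrder)
open import Relation.Binary.Definitions using (tri<; tri≈; tri>)
import Relation.Binary.Construct.Flip.EqAndOrd as Flip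

∈-remove : {A : Set} {x y : A} {xs : List A} (p : x ∈ xs) → y ∈ xs → y ≢ x → y ∈ (xs ─ p)
∈-remove (here refl) (here refl) y≢x = ⊥-elim (y≢x refl)
∈-remove (here refl) (there q)   y≢x = q
∈-remove (there p)   (here refl) y≢x = here refl
∈-remove (there p)   (there q)   y≢x = there (∈-remove p q y≢x)

∈-remove⁻ : {A : Set} {x y : A} {xs : List A} (p : x ∈ xs) → y ∈ (xs ─ p) → y ∈ xs
∈-remove⁻ (here refl) q           = there q
∈-remove⁻ (there p)   (here refl) = here refl
∈-remove⁻ (there p)   (there q)   = there (∈-remove⁻ p q)

Ord-isStrictTotalOrder : {A : Set} {_<_ : A → A → Set} → IsStrictTotalOrder _≡_ _<_ →
                         (d : Dir) → IsStrictTotalOrder _≡_ (Ord _<_ d)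
Ord-isStrictTotalOrder sto up   = sto
Ord-isStrictTotalOrder sto down = Flip.isStrictTotalOrder sto

module _ {A : Set} {_<_ : A → A → Set} (sto : IsStrictTotalOrder _≡_ _<_) (d : Dir) where

  open IsStrictTotalOrder (Ord-isStrictTotalOrder sto d) using (compare; trans; irrefl; asym)

  _≺_ : A → A → Set
  _≺_ = Ord _<_ d

  ≺⇒≢ : {x y : A} → x ≺ y → y ≢ x
  ≺⇒≢ x≺y refl = irrefl refl x≺y

  Eligible-trans : {l : Maybe A} {x y : A} → Eligible _<_ d l x → x ≺ y → Eligible _<_ d l y
  Eligible-trans {nothing} _   _   = tt
  Eligible-trans {just l}  l≺x x≺y = trans l≺x x≺y

  RunAfter : Maybe A → List A → Set
  RunAfter nothing  xs = IsRun _<_ d xs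
  RunAfter (just l) xs = IsRun _<_ d (l ∷ xs)

  RunAfter-uncons : {l : Maybe A} {x : A} {xs : List A} →
                    RunAfter l (x ∷ xs) → Eligible _<_ d l x × RunAfter (just x) xs
  RunAfter-uncons {nothing} run         = tt , run
  RunAfter-uncons {just l}  (l≺x ∷ run) = l≺x , run

  MaxRunFrom-writesEligible : {last : Maybe A} {c : Config A} {r : List A} {y : A} →
                              MaxRunFrom _<_ d last c r →
                              y ∈ buffer c → Eligible _<_ d last y → y ∈ r
  MaxRunFrom-writesEligible {nothing} (stop empty) y∈c _ = ⊥-elim (¬Any[] (subst (_ ∈_) empty y∈c))
  MaxRunFrom-writesEligible {just l} (stop below) y∈c l≺y = ⊥-elim (asym l≺y (below y∈c))
  MaxRunFrom-writesEligible {y = y} (step {x = a} p _ least rest) y∈c ey with compare a y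
  ... | tri< a≺y _ _ = there (MaxRunFrom-writesEligible rest (∈-++⁺ˡ (∈-remove p y∈c (≺⇒≢ a≺y))) a≺y)
  ... | tri≈ _ refl _ = here refl
  ... | tri> _ _ y≺a = ⊥-elim (least y∈c ey y≺a)

  -- eligible-⊆ encodes "last is not beyond last′", including the case where
  -- nothing has been written yet.
  record Ahead (last : Maybe A) (c : Config A) (last′ : Maybe A) (c′ : Config A) : Set where
    field
      same-input : input c ≡ input c′
      eligible-⊆ : ∀ {y} → Eligible _<_ d last′ y → Eligible _<_ d last y
      buffer-⊆   : ∀ {y} → y ∈ buffer c′ → Eligible _<_ d last′ y → y ∈ buffer c

  module _ {last last′ : Maybe A} {c c′ : Config A} (ahead : Ahead last c last′ c′) where
    open Ahead ahead

    Ahead-next : {a x : A} (p : a ∈ buffer c) →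
                 (∀ {y} → y ∈ buffer c → Eligible _<_ d last y → ¬ y ≺ a) →
                 (p′ : x ∈ buffer c′) → Eligible _<_ d last′ x →
                 Ahead (just a) (next c p) (just x) (next c′ p′)
    Ahead-next {a} {x} p least p′ ex = record
      { same-input = cong (drop 1) same-input
      ; eligible-⊆ = a≺
      ; buffer-⊆   = buffer-next
      }
      where
      a≺ : ∀ {y} → x ≺ y → a ≺ y
      a≺ x≺y with compare a x
      ... | tri< a≺x _ _ = trans a≺x x≺y
      ... | tri≈ _ refl _ = x≺y
      ... | tri> _ _ x≺a = ⊥-elim (least (buffer-⊆ p′ ex) (eligible-⊆ ex) x≺a)

      buffer-next : ∀ {y} → y ∈ buffer (next c′ p′) → x ≺ y → y ∈ buffer (next c p)
      buffer-next y∈ x≺y with ∈-++⁻ (buffer c′ ─ p′) y∈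
      ... | inj₁ y∈c′ = ∈-++⁺ˡ (∈-remove p (buffer-⊆ (∈-remove⁻ p′ y∈c′) (Eligible-trans {last′} ex x≺y))
                                          (≺⇒≢ (a≺ x≺y)))
      ... | inj₂ y∈input = ∈-++⁺ʳ (buffer c ─ p) (subst (λ i → _ ∈ take 1 i) (sym same-input) y∈input)

  MaxRunFrom-covers : {last last′ : Maybe A} {c c′ c″ : Config A} {r r′ : List A} →
                      Ahead last c last′ c′ → MaxRunFrom _<_ d last c r →
                      Writes c′ r′ c″ → RunAfter last′ r′ → Covers r r′
  MaxRunFrom-covers ahead m (write p′ w) run y∈r′ with RunAfter-uncons run
  ... | ex , run′ with MaxRunFrom-writesEligible m (Ahead.buffer-⊆ ahead p′ ex) (Ahead.eligible-⊆ ahead ex)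
                    | m | y∈r′
  ... | x∈r | _                  | here refl = x∈r
  ... | ()  | stop _             | there _
  ... | _   | step p _ least m′  | there q   =
    there (MaxRunFrom-covers (Ahead-next ahead p least p′ ex) m′ w run′ q)

lemma2 : {A : Set} {_<_ : A → A → Set} → IsStrictTotalOrder _≡_ _<_ →
         (M : ℕ) (I : List A) (c : Config A) → DecisionPoint _<_ M I c →
         (d : Dir) (r : List A) → MaxRun _<_ d c r →
         (r' : List A) (c' : Config A) → Writes c r' c' → IsRun _<_ d r' →
         Covers r r'
lemma2 sto M I c _ d r maxRun r' c' writes run =
  MaxRunFrom-covers sto d start maxRun writes run
  where
  start : Ahead sto d nothing c nothing c
  start = record { same-input = refl ; eligible-⊆ = λ e → e ; buffer-⊆ = λ y∈c _ → y∈c }
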